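{- Let $G$ and $H$ be finite groups, $X$ a finite $G$-set, and $f:X\to H$ a $G$-perfect nonlinear function. Let $S_h:=f^{ -1}(h)$ for $h\in H$, let $f(X)$ be the image of $f$, and $K:=\{|S_h|: h\in f(X)\}$. Then $\{S_h: h\in f(X)\}$ is a partitioned $G$--$(|X|,K,|X|/|H|)$ difference family of $X$.
   Context: $X$ is a $G$-set (a set with an action $(\alpha,x)\mapsto\alpha x$ of $G$). $f$ is $G$-perfect nonlinear if $|H|$ divides $|X|$ and for all $\alpha\in G\setminus\{1_G\}$ and $\sigma\in H$, $|\{x\in X: f(\alpha x)f(x)^{ -1}=\sigma\}|=|X|/|H|$. For a family $\mathcal F=\{S_1,\dots,S_p\}$ of nonempty subsets of $X$ with $K=\{|S_i|:1\le i\le p\}$: $\mathcal F$ is a $G$--$(v,K,\ell)$ difference family of $X$ ($v=|X|$) if for every $\alpha\in G\setminus\{1_G\}$ there are exactly $\ell$ pairs $(x,y)\in\bigcup_{i=1}^p(S_i\times S_i)$ with $\alpha x=y$; it is partitioned if moreover $\mathcal F$ is a partition of $X$. -}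

module Defs where

open import Data.Nat using (ℕ; NonZero)
open import Data.Nat.Divisibility using (_∣_)
open import Data.Nat.DivMod using (_/_)
open import Data.Fin using (Fin)
open import Data.Fin.Subset using (Subset; _∈_; ∣_∣; Nonempty)
open import Data.Fin.Subset.Properties using (_∈?_)
open import Data.Fin.Properties using (_≟_) renaming (any? to anyFin?)
open import Data.List using (List; length; filter; lookup; map; allFin; cartesianProduct)
open import Data.List.Relation.Unary.Any using (Any; any?)
open import Data.List.Relation.Unary.All using (All)
open import Data.Product using (_×_; Σ; ∃; _,_; proj₁; proj₂)
open import Data.Product.Properties using () 
open import Relation.Nullary using (¬_; does)
open import Relation.Nullary.Decidable using (_×-dec_)
open import Relation.Unary using (Decidable)
open import Relation.Binary.PropositionalEquality using (_≡_; _≢_)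
open import Algebra.Structures using (IsGroup)
open import Function.Bundles using (_⇔_)
open import Data.Vec using (tabulate)

-- A finite group, presented (up to isomorphism) on the carrier Fin m,
-- with propositional equality as the group equality.
record FinGroup (m : ℕ) : Set where
  field
    _∙_     : Fin m → Fin m → Fin m
    e       : Fin m
    _⁻¹     : Fin m → Fin m
    isGroup : IsGroup _≡_ _∙_ e _⁻¹

record GAction {m : ℕ} (G : FinGroup m) (n : ℕ) : Set where
  open FinGroup G
  field
    act      : Fin m → Fin n → Fin n
    act-id   : ∀ x → act e x ≡ x
    act-comp : ∀ α β x → act (α ∙ β) x ≡ act α (act β x)

countL : ∀ {A : Set} {P : A → Set} → Decidable P → List A → ℕ
countL P? xs = length (filter P? xs)

count : ∀ {n} {P : Fin n → Set} → Decidable P → ℕ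
count {n} P? = countL P? (allFin n)

PerfectNonlinear : ∀ {m n k} (G : FinGroup m) (H : FinGroup k) → .{{NonZero k}} →
                   GAction G n → (Fin n → Fin k) → Set
PerfectNonlinear {m} {n} {k} G H A f =
  (k ∣ n) ×
  (∀ (α : Fin m) → α ≢ FinGroup.e G → ∀ (σ : Fin k) →
     count (λ x → FinGroup._∙_ H (f (GAction.act A α x)) (FinGroup._⁻¹ H (f x)) ≟ σ)
       ≡ n / k)

pairCount : ∀ {m n} {G : FinGroup m} → GAction G n → List (Subset n) → Fin m → ℕ
pairCount {n = n} A F α =
  countL (λ p → (GAction.act A α (proj₁ p) ≟ proj₂ p)
                ×-dec any? (λ S → (proj₁ p ∈? S) ×-dec (proj₂ p ∈? S)) F)
         (cartesianProduct (allFin n) (allFin n))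

-- F is a G-(v,K,ℓ) difference family of X = Fin n; K is a set of naturals
-- given as a predicate and must be exactly { |S| : S ∈ F }.
DifferenceFamily : ∀ {m n} {G : FinGroup m} → GAction G n →
                   (v : ℕ) (K : ℕ → Set) (ℓ : ℕ) → List (Subset n) → Set
DifferenceFamily {n = n} {G = G} A v K ℓ F =
  (v ≡ n) ×
  All Nonempty F ×
  (∀ c → K c ⇔ Any (λ S → ∣ S ∣ ≡ c) F) ×
  (∀ α → α ≢ FinGroup.e G → pairCount A F α ≡ ℓ)

IsPartition : ∀ {n} → List (Subset n) → Set
IsPartition {n} F =
  All Nonempty F ×
  (∀ i j → i ≢ j → ∀ (x : Fin n) → ¬ (x ∈ lookup F i × x ∈ lookup F j)) ×
  (∀ (x : Fin n) → Any (x ∈_) F)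

PartitionedDifferenceFamily : ∀ {m n} {G : FinGroup m} → GAction G n →
                   (v : ℕ) (K : ℕ → Set) (ℓ : ℕ) → List (Subset n) → Set
PartitionedDifferenceFamily A v K ℓ F = DifferenceFamily A v K ℓ F × IsPartition F

fibre : ∀ {n k} → (Fin n → Fin k) → Fin k → Subset n
fibre f σ = tabulate (λ x → does (f x ≟ σ))

InImage : ∀ {n k} → (Fin n → Fin k) → Fin k → Set
InImage f σ = ∃ λ x → f x ≡ σ

inImage? : ∀ {n k} (f : Fin n → Fin k) → Decidable (InImage f)
inImage? f σ = anyFin? (λ x → f x ≟ σ)

-- the family { S_σ : σ ∈ f(X) } (listed once per element of the image)
fibreFamily : ∀ {n k} → (Fin n → Fin k) → List (Subset n)
fibreFamily {k = k} f = map (fibre f) (filter (inImage? f) (allFin k))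

-- Two points lie in a common fibre of f exactly when they have the same image, so for α ≠ 1
-- the pairs (x , α x) counted by the difference family are the x with f (α x) f (x)⁻¹ = 1.
-- Perfect nonlinearity at σ = 1 says there are |X|/|H| of them; that the fibres over the
-- image are nonempty, pairwise disjoint and cover X is bookkeeping.
module Submission where

open import Defs
open import Level using (0ℓ)
open import Data.Nat using (NonZero; suc; _+_)
open import Data.Nat.DivMod using (_/_)
open import Data.Bool using (true; false)
open import Data.Empty using (⊥-elim)
open import Data.Fin using (Fin)
import Data.Fin as Fin
open import Data.Fin.Properties using (_≟_; suc-injective)
open import Data.Fin.Subset using (Subset; _∈_; ∣_∣; Nonempty)
open import Data.List using (List; []; _∷_; [_]; _++_; length; filter; map; tabulate; allFin; lookup; cartesianProduct)
open import Data.List.Properties using (length-++; filter-++; filter-≐; filter-none; map-tabulate)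
open import Data.List.Relation.Unary.Any using (Any)
open import Data.List.Relation.Unary.All as All using (All)
import Data.List.Relation.Unary.All.Properties as All
open import Data.List.Relation.Unary.AllPairs as AllPairs using (AllPairs; _∷_)
import Data.List.Relation.Unary.AllPairs.Properties as AllPairs
open import Data.List.Relation.Unary.Unique.Propositional.Properties using (allFin⁺)
open import Data.List.Membership.Propositional using (find; lose) renaming (_∈_ to _∈ₗ_)
open import Data.List.Membership.Propositional.Properties using (∈-allFin; ∈-lookup; ∈-map∘filter⁺; ∈-map∘filter⁻)
open import Data.Product using (_×_; ∃; _,_; proj₁; proj₂; swap; map₂)
open import Data.Vec.Properties using (lookup∘tabulate; lookup⇒[]=; []=⇒lookup)
open import Function using (_∘_; case_of_)
open import Function.Bundles using (_⇔_; mk⇔; Equivalence)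
open import Relation.Nullary using (¬_; Dec; yes; no)
open import Relation.Nullary.Decidable using (_×-dec_; dec-true)
open import Relation.Unary using (Pred; Decidable; _≐_)
open import Relation.Binary using (Rel; Symmetric)
open import Relation.Binary.PropositionalEquality using (_≡_; _≢_; refl; sym; trans; cong; cong₂; module ≡-Reasoning)
open import Algebra.Bundles using (Group)
open import Algebra.Properties.Group using (x∙y⁻¹≈ε⇒x≈y)

open ≡-Reasoning

module _ {A : Set} where

  countL-none : {P : Pred A 0ℓ} (P? : Decidable P) {xs : List A} → All (¬_ ∘ P) xs →
                countL P? xs ≡ 0
  countL-none P? ¬Pxs = cong length (filter-none P? ¬Pxs)

  countL-++ : {P : Pred A 0ℓ} (P? : Decidable P) (xs ys : List A) →
              countL P? (xs ++ ys) ≡ countL P? xs + countL P? ys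
  countL-++ P? xs ys = trans (cong length (filter-++ P? xs ys)) (length-++ (filter P? xs))

  countL-≐ : {P Q : Pred A 0ℓ} (P? : Decidable P) (Q? : Decidable Q) → P ≐ Q →
             (xs : List A) → countL P? xs ≡ countL Q? xs
  countL-≐ P? Q? P≐Q xs = cong length (filter-≐ P? Q? P≐Q xs)

  countL-map : {B : Set} {P : Pred B 0ℓ} (P? : Decidable P) (g : A → B) (xs : List A) →
               countL P? (map g xs) ≡ countL (P? ∘ g) xs
  countL-map P? g []       = refl
  countL-map P? g (x ∷ xs) with Dec.does (P? (g x))
  ... | true  = cong suc (countL-map P? g xs)
  ... | false = countL-map P? g xs

-- countL P? [ a ] serves as the indicator of P a.
count-at : ∀ {n} {P : Pred (Fin n) 0ℓ} (P? : Decidable P) (a : Fin n) →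
           count (λ y → (a ≟ y) ×-dec P? y) ≡ countL P? [ a ]
count-at {suc n} P? Fin.zero with Dec.does (P? Fin.zero)
... | true  = cong suc (countL-none (λ y → (Fin.zero ≟ y) ×-dec P? y) (All.tabulate⁺ {f = Fin.suc} λ { _ (() , _) }))
... | false = countL-none (λ y → (Fin.zero ≟ y) ×-dec P? y) (All.tabulate⁺ {f = Fin.suc} λ { _ (() , _) })
count-at {suc n} {P} P? (Fin.suc a) = begin
  countL Q? (tabulate Fin.suc)        ≡⟨ cong (countL Q?) (map-tabulate (λ i → i) Fin.suc) ⟨
  countL Q? (map Fin.suc (allFin n))  ≡⟨ countL-map Q? Fin.suc (allFin n) ⟩
  count (Q? ∘ Fin.suc)                ≡⟨ countL-≐ (Q? ∘ Fin.suc) Q′? suc-cancel (allFin n) ⟩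
  count Q′?                           ≡⟨ count-at (P? ∘ Fin.suc) a ⟩
  countL (P? ∘ Fin.suc) [ a ]         ≡⟨ countL-map P? Fin.suc [ a ] ⟨
  countL P? [ Fin.suc a ]             ∎
  where
  Q? : Decidable (λ y → Fin.suc a ≡ y × P y)
  Q? y = (Fin.suc a ≟ y) ×-dec P? y

  Q′? : Decidable (λ y → a ≡ y × P (Fin.suc y))
  Q′? y = (a ≟ y) ×-dec P? (Fin.suc y)

  suc-cancel : (λ y → Fin.suc a ≡ Fin.suc y × P (Fin.suc y)) ≐ (λ y → a ≡ y × P (Fin.suc y))
  suc-cancel = (λ (e , p) → suc-injective e , p) , (λ (e , p) → cong Fin.suc e , p)

countL-graph : ∀ {A : Set} {n} {R : Pred (A × Fin n) 0ℓ} (R? : Decidable R) (g : A → Fin n) (xs : List A) →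
               countL (λ p → (g (proj₁ p) ≟ proj₂ p) ×-dec R? p) (cartesianProduct xs (allFin n))
                 ≡ countL (λ x → R? (x , g x)) xs
countL-graph         R? g []       = refl
countL-graph {n = n} {R = R} R? g (x ∷ xs) = begin
  countL Q? (map (x ,_) (allFin n) ++ cartesianProduct xs (allFin n))
    ≡⟨ countL-++ Q? (map (x ,_) (allFin n)) _ ⟩
  countL Q? (map (x ,_) (allFin n)) + countL Q? (cartesianProduct xs (allFin n))
    ≡⟨ cong₂ _+_ (countL-map Q? (x ,_) (allFin n)) (countL-graph R? g xs) ⟩
  count (λ y → (g x ≟ y) ×-dec R? (x , y)) + countL R∘graph? xs
    ≡⟨ cong (_+ countL R∘graph? xs) (count-at (R? ∘ (x ,_)) (g x)) ⟩
  countL (R? ∘ (x ,_)) [ g x ] + countL R∘graph? xs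
    ≡⟨ cong (_+ countL R∘graph? xs) (countL-map R? (x ,_) [ g x ]) ⟨
  countL R? [ x , g x ] + countL R∘graph? xs
    ≡⟨ cong (_+ countL R∘graph? xs) (countL-map R? (λ z → z , g z) [ x ]) ⟩
  countL R∘graph? [ x ] + countL R∘graph? xs
    ≡⟨ countL-++ R∘graph? [ x ] xs ⟨
  countL R∘graph? (x ∷ xs) ∎
  where
  Q? : Decidable (λ p → g (proj₁ p) ≡ proj₂ p × R p)
  Q? p = (g (proj₁ p) ≟ proj₂ p) ×-dec R? p

  R∘graph? : Decidable (λ z → R (z , g z))
  R∘graph? z = R? (z , g z)

Disjoint : ∀ {n} → Rel (Subset n) 0ℓ
Disjoint S T = ∀ x → ¬ (x ∈ S × x ∈ T)

Disjoint-sym : ∀ {n} → Symmetric (Disjoint {n})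
Disjoint-sym S∩T=∅ x = S∩T=∅ x ∘ swap

AllPairs-lookup : ∀ {A : Set} {ℓ} {R : Rel A ℓ} → Symmetric R → {xs : List A} → AllPairs R xs →
                  ∀ i j → i ≢ j → R (lookup xs i) (lookup xs j)
AllPairs-lookup R-sym (Rx ∷ Rxs) Fin.zero    Fin.zero    i≢j = ⊥-elim (i≢j refl)
AllPairs-lookup R-sym (Rx ∷ Rxs) Fin.zero    (Fin.suc j) i≢j = All.lookup Rx (∈-lookup j)
AllPairs-lookup R-sym (Rx ∷ Rxs) (Fin.suc i) Fin.zero    i≢j = R-sym (All.lookup Rx (∈-lookup i))
AllPairs-lookup R-sym (Rx ∷ Rxs) (Fin.suc i) (Fin.suc j) i≢j = AllPairs-lookup R-sym Rxs i j (i≢j ∘ cong Fin.suc)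

module _ {n k} (f : Fin n → Fin k) where

  ∈-fibre⁺ : ∀ {x σ} → f x ≡ σ → x ∈ fibre f σ
  ∈-fibre⁺ {x} {σ} fx≡σ = lookup⇒[]= x (fibre f σ) (trans (lookup∘tabulate _ x) (dec-true (f x ≟ σ) fx≡σ))

  ∈-fibre⁻ : ∀ {x σ} → x ∈ fibre f σ → f x ≡ σ
  ∈-fibre⁻ {x} {σ} x∈S with f x ≟ σ | trans (sym (lookup∘tabulate _ x)) ([]=⇒lookup x∈S)
  ... | yes fx≡σ | _ = fx≡σ
  ... | no _     | ()

  fibres-disjoint : ∀ {σ τ} → σ ≢ τ → Disjoint (fibre f σ) (fibre f τ)
  fibres-disjoint σ≢τ x (x∈Sσ , x∈Sτ) = σ≢τ (trans (sym (∈-fibre⁻ x∈Sσ)) (∈-fibre⁻ x∈Sτ))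

  fibre∈fibreFamily : ∀ {σ} → InImage f σ → fibre f σ ∈ₗ fibreFamily f
  fibre∈fibreFamily {σ} σ∈f[X] = ∈-map∘filter⁺ (fibre f) (inImage? f) (σ , ∈-allFin σ , refl , σ∈f[X])

  ∈-fibreFamily⁻ : ∀ {S} → S ∈ₗ fibreFamily f → ∃ λ σ → InImage f σ × S ≡ fibre f σ
  ∈-fibreFamily⁻ S∈F with σ , _ , S≡Sσ , σ∈f[X] ← ∈-map∘filter⁻ (fibre f) (inImage? f) {xs = allFin k} S∈F = σ , σ∈f[X] , S≡Sσ

  fibreFamily-nonempty : All Nonempty (fibreFamily f)
  fibreFamily-nonempty = All.tabulate λ S∈F → case ∈-fibreFamily⁻ S∈F of λ where
    (σ , (x , fx≡σ) , refl) → x , ∈-fibre⁺ fx≡σ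

  fibreFamily-covers : ∀ x → Any (x ∈_) (fibreFamily f)
  fibreFamily-covers x = lose (fibre∈fibreFamily (x , refl)) (∈-fibre⁺ refl)

  fibreFamily-pairwiseDisjoint : AllPairs Disjoint (fibreFamily f)
  fibreFamily-pairwiseDisjoint =
    AllPairs.map⁺ (AllPairs.filter⁺ (inImage? f) (AllPairs.map fibres-disjoint (allFin⁺ k)))

  fibreFamily-sizes : ∀ c → (∃ λ σ → InImage f σ × ∣ fibre f σ ∣ ≡ c) ⇔ Any (λ S → ∣ S ∣ ≡ c) (fibreFamily f)
  fibreFamily-sizes c = mk⇔
    (λ (σ , σ∈f[X] , ∣Sσ∣≡c) → lose (fibre∈fibreFamily σ∈f[X]) ∣Sσ∣≡c)
    (λ ∣S∣≡c → case find ∣S∣≡c of λ where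
      (S , S∈F , ∣S∣≡c) → case ∈-fibreFamily⁻ S∈F of λ where
        (σ , σ∈f[X] , refl) → σ , σ∈f[X] , ∣S∣≡c)

  sameFibre⇔ : ∀ {x y} → Any (λ S → x ∈ S × y ∈ S) (fibreFamily f) ⇔ f x ≡ f y
  sameFibre⇔ {x} {y} = mk⇔
    (λ x,y∈S → case find x,y∈S of λ where
      (S , S∈F , x∈S , y∈S) → case ∈-fibreFamily⁻ S∈F of λ where
        (σ , _ , refl) → trans (∈-fibre⁻ x∈S) (sym (∈-fibre⁻ y∈S)))
    (λ fx≡fy → lose (fibre∈fibreFamily (x , refl)) (∈-fibre⁺ refl , ∈-fibre⁺ (sym fx≡fy)))

pairCount-fibreFamily : ∀ {m n k} {G : FinGroup m} (A : GAction G n) (f : Fin n → Fin k) α →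
                        pairCount A (fibreFamily f) α ≡ count (λ x → f x ≟ f (GAction.act A α x))
pairCount-fibreFamily {n = n} A f α = begin
  pairCount A (fibreFamily f) α
    ≡⟨ countL-≐ _ _ (map₂ (Equivalence.to (sameFibre⇔ f)) , map₂ (Equivalence.from (sameFibre⇔ f))) pairs ⟩
  countL (λ p → (act α (proj₁ p) ≟ proj₂ p) ×-dec (f (proj₁ p) ≟ f (proj₂ p))) pairs
    ≡⟨ countL-graph (λ p → f (proj₁ p) ≟ f (proj₂ p)) (act α) (allFin n) ⟩
  count (λ x → f x ≟ f (act α x)) ∎
  where
  open GAction A

  pairs : List (Fin n × Fin n)
  pairs = cartesianProduct (allFin n) (allFin n)

module _ {k} (H : FinGroup k) where
  open FinGroup H

  x∙y⁻¹≡e⇔x≡y : ∀ {a b} → a ∙ (b ⁻¹) ≡ e ⇔ a ≡ b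
  x∙y⁻¹≡e⇔x≡y {a} {b} = mk⇔ (x∙y⁻¹≈ε⇒x≈y group a b) λ where refl → inverseʳ b
    where
    group : Group _ _
    group = record { isGroup = isGroup }
    open Group group using (inverseʳ)

corollary2p9 : ∀ {m n k} (G : FinGroup m) (H : FinGroup k) .{{_ : NonZero k}}
                 (A : GAction G n) (f : Fin n → Fin k) →
                 PerfectNonlinear G H A f →
                 PartitionedDifferenceFamily A n
                   (λ c → ∃ λ σ → InImage f σ × ∣ fibre f σ ∣ ≡ c)
                   (n / k) (fibreFamily f)
corollary2p9 {n = n} {k} G H A f (_ , perfect) =
  (refl , fibreFamily-nonempty f , fibreFamily-sizes f , pairCount≡n/k) ,
  fibreFamily-nonempty f ,
  AllPairs-lookup Disjoint-sym (fibreFamily-pairwiseDisjoint f) ,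
  fibreFamily-covers f
  where
  open FinGroup H
  open GAction A

  pairCount≡n/k : ∀ α → α ≢ FinGroup.e G → pairCount A (fibreFamily f) α ≡ n / k
  pairCount≡n/k α α≢e = begin
    pairCount A (fibreFamily f) α            ≡⟨ pairCount-fibreFamily A f α ⟩
    count (λ x → f x ≟ f (act α x))          ≡⟨ countL-≐ _ _ sameImage≐unitQuotient (allFin n) ⟩
    count (λ x → f (act α x) ∙ (f x ⁻¹) ≟ e) ≡⟨ perfect α α≢e e ⟩
    n / k                                    ∎
    where
    sameImage≐unitQuotient : (λ x → f x ≡ f (act α x)) ≐ (λ x → f (act α x) ∙ (f x ⁻¹) ≡ e)
    sameImage≐unitQuotient =
      (λ fx≡fαx → Equivalence.from (x∙y⁻¹≡e⇔x≡y H) (sym fx≡fαx)) ,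
      (λ fαx∙fx⁻¹≡e → sym (Equivalence.to (x∙y⁻¹≡e⇔x≡y H) fαx∙fx⁻¹≡e))
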